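{- For any conjunction $\mathbf C$ of ground literals, ground comparisons, and closed aggregate expressions, and for any list $\mathbf X$ of distinct variables containing all variables that occur in $\mathbf C$, the infinitary formula $\tau\mathbf C$ is satisfied by exactly the same interpretations of the vocabulary of $\mathbf C$ as the formula $\phi^{\mathbf X}\mathbf C$.
   Context: Terms are built from numerals $\overline n$ ($n\in\mathbb Z$), symbolic constants, variables, the symbols $\mathit{inf},\mathit{sup}$, $f(\mathbf t)$ ($f$ a symbolic constant), $\mathit{op}(\mathbf t)$ (each $n$-ary operation name has a function $\widehat{\mathit{op}}$ from a subset of $\mathbb Z^n$ to $\mathbb Z$), and intervals $(t_1..t_2)$. Ground = variable-free; precomputed = ground without operation names or intervals. A total order on precomputed terms ($\mathit{inf}$ least, $\mathit{sup}$ greatest, numerals ordered as integers) interprets $=,\neq,<,>,\le,\ge$. Values $[t]$ of ground terms: $\{t\}$ for numerals, symbolic constants, $\mathit{inf},\mathit{sup}$; $[f(t_1,..,t_n)]=\{f(r_1,..,r_n):r_i\in[t_i]\}$; $[\mathit{op}(t_1,..,t_n)]=\{\overline{\widehat{\mathit{op}}(k_1,..,k_n)}:(k_i)\in\mathrm{dom}\,\widehat{\mathit{op}},\overline{k_i}\in[t_i]\}$; $[(t_1..t_2)]=\{\overline m:k_1\le m\le k_2,\overline{k_1}\in[t_1],\overline{k_2}\in[t_2]\}$; $[t_1,..,t_n]$ = tuples of values. Literals: atoms $p(\mathbf t)$ or $\mathit{not}\ p(\mathbf t)$; comparisons $(t_1\prec t_2)$. Each aggregate name $\alpha$ has a function $\widehat\alpha$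 from sets of non-empty tuples of precomputed terms to precomputed terms. An aggregate expression is $\alpha\{\mathbf t:\mathbf C'\}\prec s$ ($\mathbf t$ non-empty tuple of terms, $\mathbf C'$ a conjunction of literals and comparisons, $s$ a variable or precomputed term); it is closed if $s$ is ground. The vocabulary of an expression is the set of atoms $p(\mathbf r)$, $\mathbf r$ an $n$-tuple of precomputed terms, such that it contains an atom $p(t_1,\dots,t_n)$. Interpretations are sets of atoms $p(\mathbf r)$ with precomputed $\mathbf r$. Formulas and arguments (mutually recursive): formulas $p(\mathbf{arg})$, $\mathit{arg}_1\prec\mathit{arg}_2$, $\mathit{arg}\in t$ ($t$ a term), $\bot$, $F\to G$, $\forall XF$; arguments are numerals, symbolic constants, variables, $\mathit{inf},\mathit{sup}$, $f(\mathbf{arg})$, and $\alpha\{\mathbf X\mid F\}$ ($\mathbf X$ non-empty tuple of distinct variables, bound in it). Semantics under $\mathcal I$: atoms true iff (with arguments evaluated) in $\mathcal I$; $\prec$ via the order; $\mathit{arg}\in t$ true iff $\mathit{arg}^{\mathcal I}\in[t]$; classical connectives; $\forall$ ranges over precomputed terms; $\alpha\{X_1..X_k\mid F\}^{\mathcal I}=\widehat\alpha(T)$ with $T$ the set of tuples $r_1..r_k$ of precomputed terms such that $F^{X_1..X_k}_{r_1..r_k}$ is true. $\phi p(\mathbf t)=\exists\mathbf X(\mathbf X\in\mathbf t\wedge p(\mathbf X))$, $\phi(\mathit{not}\ p(\mathbf t))=\exists\mathbf X(\mathbf X\in\mathbf t\wedge\neg p(\mathbf X))$, $\phi(t_1\prec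 t_2)=\exists X_1X_2(X_1\in t_1\wedge X_2\in t_2\wedge X_1\prec X_2)$ (new variables), conjunct-wise on conjunctions. $\phi^{\mathbf X}$ equals $\phi$ on literals and comparisons, $\phi^{\mathbf X}(\alpha\{\mathbf t:\mathbf C'\}\prec s)=\exists Y(\alpha\{\mathbf Z\mid\exists\mathbf X(\mathbf Z\in\mathbf t\wedge\phi\mathbf C')\}\prec Y\wedge Y\in s)$ with new $\mathbf Z,Y$, and acts conjunct-wise on conjunctions. Infinitary formulas: atoms, $\bot$, $\mathcal H^\wedge$, $\mathcal H^\vee$ for arbitrary sets $\mathcal H$, $G\to H$, with classical satisfaction; $\neg F=F\to\bot$, $\top=\neg\bot$. $\tau p(\mathbf t)=\bigvee_{\mathbf r\in[\mathbf t]}p(\mathbf r)$, $\tau(\mathit{not}\ p(\mathbf t))=\bigvee_{\mathbf r\in[\mathbf t]}\neg p(\mathbf r)$; $\tau(t_1\prec t_2)$ is $\top$ if $r_1\prec r_2$ for some $r_i\in[t_i]$, else $\bot$. For a closed aggregate expression $E=\alpha\{\mathbf t:\mathbf C'\}\prec s$, let $\mathbf Y$ list the variables occurring in $E$, $A$ the set of tuples of precomputed terms of length $|\mathbf Y|$, and for $\Delta\subseteq A$, $[\Delta]=\bigcup_{\mathbf r\in\Delta}[\mathbf t^{\mathbf Y}_{\mathbf r}]$; $\Delta$ justifies $E$ if $\widehat\alpha([\Delta])\prec s$. Then $\tau E$ is the conjunction over all $\Delta\subseteq A$ not justifying $E$ of $\bigwedge_{\mathbf r\in\Delta}\tau(\mathbf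 C'^{\mathbf Y}_{\mathbf r})\to\bigvee_{\mathbf r\in A\setminus\Delta}\tau(\mathbf C'^{\mathbf Y}_{\mathbf r})$. $\tau$ acts conjunct-wise on conjunctions. -}

module Defs where

open import Level using (Level; 0ℓ; Lift; lift; lower) renaming (suc to lsuc)
open import Data.Nat using (ℕ; suc; _+_; _≡ᵇ_)
import Data.Nat as ℕ
open import Data.Integer using (ℤ)
import Data.Integer as ℤ
open import Data.Bool using (Bool; true; false; if_then_else_)
open import Data.Fin using (Fin)
open import Data.List using (List; []; _∷_; _++_; map; length; concatMap; lookup; deduplicate)
open import Data.List.Relation.Unary.All using (All)
open import Data.Vec using (Vec; []; _∷_)
open import Data.Maybe using (Maybe; just; nothing)
open import Data.Product using (Σ; _×_; _,_; proj₁; proj₂)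
open import Data.Sum using (_⊎_)
open import Data.Empty using (⊥)
open import Data.Unit using (⊤)
open import Relation.Nullary using (¬_; Dec; yes; no)
open import Relation.Unary using (Pred)
open import Relation.Binary using (IsStrictTotalOrder)
open import Relation.Binary.PropositionalEquality using (_≡_)
open import Axiom.ExcludedMiddle using (ExcludedMiddle)

record Lang : Set₁ where
  field
    Sym     : Set
    PName   : Set
    Op      : Set
    arity   : Op → ℕ
    opFun   : (o : Op) → Vec ℤ (arity o) → Maybe ℤ
    AggName : Set

data PTerm (L : Lang) : Set where
  num : ℤ → PTerm L
  sym : Lang.Sym L → PTerm L
  inf sup : PTerm L
  app : Lang.Sym L → List (PTerm L) → PTerm L

-- The semantic parameters: the total order on precomputed terms and the
-- aggregate functions (functions on SETS, hence extensional).
record Sem (L : Lang) : Set₁ where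
  field
    _<ₚ_        : PTerm L → PTerm L → Set
    isSTO       : IsStrictTotalOrder _≡_ _<ₚ_
    inf-least   : ∀ r → ¬ r ≡ inf → inf <ₚ r
    sup-greatest : ∀ r → ¬ r ≡ sup → r <ₚ sup
    num-order   : ∀ a b → (num a <ₚ num b → a ℤ.< b) × (a ℤ.< b → num a <ₚ num b)
    aggFun      : Lang.AggName L → Pred (List (PTerm L)) 0ℓ → PTerm L
    aggFun-ext  : ∀ α (P Q : Pred (List (PTerm L)) 0ℓ) →
                  (∀ x → P x → Q x) → (∀ x → Q x → P x) → aggFun α P ≡ aggFun α Q

Var : Set
Var = ℕ

data Cmp : Set where
  eq neq lt gt le ge : Cmp

module Gringo (L : Lang) (S : Sem L) where
  open Lang L
  open Sem S

  data Term : Set where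
    tnum : ℤ → Term
    tsym : Sym → Term
    tvar : Var → Term
    tinf tsup : Term
    tapp : Sym → List Term → Term
    top  : (o : Op) → Vec Term (arity o) → Term
    _‥_  : Term → Term → Term

  data Lit : Set where
    pos : PName → List Term → Lit
    neg : PName → List Term → Lit

  data BodyElem : Set where
    lit : Lit → BodyElem
    cmp : Cmp → Term → Term → BodyElem

  -- conjuncts of C: literals, comparisons, aggregate expressions
  -- agg α t C' ≺ s   stands for   α{t : C'} ≺ s
  data Elem : Set where
    lit : Lit → Elem
    cmp : Cmp → Term → Term → Elem
    agg : AggName → List Term → List BodyElem → Cmp → Term → Elem

  mutual
    varsT : Term → List Var
    varsT (tnum _) = []
    varsT (tsym _) = []
    varsT (tvar x) = x ∷ []
    varsT tinf = []
    varsT tsup = []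
    varsT (tapp _ ts) = varsTs ts
    varsT (top _ ts) = varsV ts
    varsT (t₁ ‥ t₂) = varsT t₁ ++ varsT t₂

    varsTs : List Term → List Var
    varsTs [] = []
    varsTs (t ∷ ts) = varsT t ++ varsTs ts

    varsV : ∀ {n} → Vec Term n → List Var
    varsV [] = []
    varsV (t ∷ ts) = varsT t ++ varsV ts

  varsLit : Lit → List Var
  varsLit (pos _ ts) = varsTs ts
  varsLit (neg _ ts) = varsTs ts

  varsB : BodyElem → List Var
  varsB (lit l) = varsLit l
  varsB (cmp _ t₁ t₂) = varsT t₁ ++ varsT t₂

  varsBs : List BodyElem → List Var
  varsBs = concatMap varsB

  varsE : Elem → List Var
  varsE (lit l) = varsLit l
  varsE (cmp _ t₁ t₂) = varsT t₁ ++ varsT t₂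
  varsE (agg _ ts C' _ s) = varsTs ts ++ varsBs C' ++ varsT s

  varsC : List Elem → List Var
  varsC = concatMap varsE

  Ground : Term → Set
  Ground t = varsT t ≡ []

  data Precomputed : Term → Set where
    num : ∀ n → Precomputed (tnum n)
    sym : ∀ c → Precomputed (tsym c)
    inf : Precomputed tinf
    sup : Precomputed tsup
    app : ∀ f ts → All Precomputed ts → Precomputed (tapp f ts)

  -- well-formedness of the conjuncts of C as required by the lemma:
  -- ground literals, ground comparisons, closed aggregate expressions
  -- (t non-empty, s a variable or precomputed term, and s ground, i.e. s precomputed)
  data GroundOrClosed : Elem → Set where
    lit : ∀ l → varsLit l ≡ [] → GroundOrClosed (lit l)
    cmp : ∀ ≺ t₁ t₂ → Ground t₁ → Ground t₂ → GroundOrClosed (cmp ≺ t₁ t₂)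
    agg : ∀ α ts C' ≺ s → ¬ ts ≡ [] → Precomputed s → GroundOrClosed (agg α ts C' ≺ s)

  mutual
    val : Term → Pred (PTerm L) 0ℓ
    val (tnum n) r = r ≡ num n
    val (tsym c) r = r ≡ sym c
    val (tvar x) r = ⊥
    val tinf r = r ≡ inf
    val tsup r = r ≡ sup
    val (tapp f ts) r = Σ (List (PTerm L)) λ rs → r ≡ app f rs × valL ts rs
    val (top o ts) r = Σ (Vec ℤ (arity o)) λ ks → Σ ℤ λ k →
                         opFun o ks ≡ just k × r ≡ num k × valNums ts ks
    val (t₁ ‥ t₂) r = Σ ℤ λ m → Σ ℤ λ k₁ → Σ ℤ λ k₂ →
                         r ≡ num m × k₁ ℤ.≤ m × m ℤ.≤ k₂ × val t₁ (num k₁) × val t₂ (num k₂)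

    valL : List Term → Pred (List (PTerm L)) 0ℓ
    valL [] rs = rs ≡ []
    valL (t ∷ ts) [] = ⊥
    valL (t ∷ ts) (r ∷ rs) = val t r × valL ts rs

    valNums : ∀ {n} → Vec Term n → Vec ℤ n → Set
    valNums [] [] = ⊤
    valNums (t ∷ ts) (k ∷ ks) = val t (num k) × valNums ts ks

  mutual
    embed : PTerm L → Term
    embed (num n) = tnum n
    embed (sym c) = tsym c
    embed inf = tinf
    embed sup = tsup
    embed (app f rs) = tapp f (embedL rs)

    embedL : List (PTerm L) → List Term
    embedL [] = []
    embedL (r ∷ rs) = embed r ∷ embedL rs

  Subst : Set
  Subst = Var → Maybe (PTerm L)

  mutual
    substT : Subst → Term → Term
    substT σ (tnum n) = tnum n
    substT σ (tsym c) = tsym c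
    substT σ (tvar x) with σ x
    ... | just r = embed r
    ... | nothing = tvar x
    substT σ tinf = tinf
    substT σ tsup = tsup
    substT σ (tapp f ts) = tapp f (substTs σ ts)
    substT σ (top o ts) = top o (substV σ ts)
    substT σ (t₁ ‥ t₂) = substT σ t₁ ‥ substT σ t₂

    substTs : Subst → List Term → List Term
    substTs σ [] = []
    substTs σ (t ∷ ts) = substT σ t ∷ substTs σ ts

    substV : ∀ {n} → Subst → Vec Term n → Vec Term n
    substV σ [] = []
    substV σ (t ∷ ts) = substT σ t ∷ substV σ ts

  substLit : Subst → Lit → Lit
  substLit σ (pos p ts) = pos p (substTs σ ts)
  substLit σ (neg p ts) = neg p (substTs σ ts)

  substB : Subst → BodyElem → BodyElem
  substB σ (lit l) = lit (substLit σ l)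
  substB σ (cmp ≺ t₁ t₂) = cmp ≺ (substT σ t₁) (substT σ t₂)

  mkSub : (Y : List Var) → Vec (PTerm L) (length Y) → Subst
  mkSub [] [] x = nothing
  mkSub (y ∷ Y) (r ∷ rs) x = if x ≡ᵇ y then just r else mkSub Y rs x

  holds : Cmp → PTerm L → PTerm L → Set
  holds eq a b = a ≡ b
  holds neq a b = ¬ a ≡ b
  holds lt a b = a <ₚ b
  holds gt a b = b <ₚ a
  holds le a b = a <ₚ b ⊎ a ≡ b
  holds ge a b = b <ₚ a ⊎ a ≡ b

  Atom : Set
  Atom = PName × List (PTerm L)

  Interp : Set₁
  Interp = Pred Atom 0ℓ

  predsLit : Lit → List (PName × ℕ)
  predsLit (pos p ts) = (p , length ts) ∷ []
  predsLit (neg p ts) = (p , length ts) ∷ []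

  predsB : BodyElem → List (PName × ℕ)
  predsB (lit l) = predsLit l
  predsB (cmp _ _ _) = []

  predsE : Elem → List (PName × ℕ)
  predsE (lit l) = predsLit l
  predsE (cmp _ _ _) = []
  predsE (agg _ _ C' _ _) = concatMap predsB C'

  data _∈ₗ_ {A : Set} (x : A) : List A → Set where
    here  : ∀ {xs} → x ∈ₗ (x ∷ xs)
    there : ∀ {y xs} → x ∈ₗ xs → x ∈ₗ (y ∷ xs)

  Voc : List Elem → Pred Atom 0ℓ
  Voc C (p , rs) = (p , length rs) ∈ₗ concatMap predsE C

  mutual
    data Arg : Set where
      anum : ℤ → Arg
      asym : Sym → Arg
      avar : Var → Arg
      ainf asup : Arg
      aapp : Sym → List Arg → Arg
      aagg : AggName → List Var → Formula → Arg

    data Formula : Set where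
      fatom : PName → List Arg → Formula
      fcmp  : Cmp → Arg → Arg → Formula
      fmem  : Arg → Term → Formula
      fbot  : Formula
      _⇒_   : Formula → Formula → Formula
      fall  : Var → Formula → Formula

  fneg : Formula → Formula
  fneg F = F ⇒ fbot

  ftop : Formula
  ftop = fneg fbot

  _∧ᶠ_ : Formula → Formula → Formula
  F ∧ᶠ G = fneg (F ⇒ fneg G)

  fex : Var → Formula → Formula
  fex x F = fneg (fall x (fneg F))

  fexs : List Var → Formula → Formula
  fexs [] F = F
  fexs (x ∷ xs) F = fex x (fexs xs F)

  conjᶠ : List Formula → Formula
  conjᶠ [] = ftop
  conjᶠ (F ∷ []) = F
  conjᶠ (F ∷ G ∷ Fs) = F ∧ᶠ conjᶠ (G ∷ Fs)

  memAll : List Var → List Term → Formula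
  memAll Xs ts = conjᶠ (go Xs ts)
    where
    go : List Var → List Term → List Formula
    go (x ∷ xs) (t ∷ ts) = fmem (avar x) t ∷ go xs ts
    go _ _ = []

  Env : Set
  Env = Var → PTerm L

  _[_↦_] : Env → Var → PTerm L → Env
  (ρ [ x ↦ r ]) y = if y ≡ᵇ x then r else ρ y

  updates : Env → List Var → List (PTerm L) → Env
  updates ρ (x ∷ xs) (r ∷ rs) = updates (ρ [ x ↦ r ]) xs rs
  updates ρ _ _ = ρ

  -- satisfaction (free variables are interpreted by an environment; this
  -- is the same as substituting precomputed terms for them)
  mutual
    evalArg : Interp → Env → Arg → PTerm L
    evalArg I ρ (anum n) = num n
    evalArg I ρ (asym c) = sym c
    evalArg I ρ (avar x) = ρ x
    evalArg I ρ ainf = inf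
    evalArg I ρ asup = sup
    evalArg I ρ (aapp f as) = app f (evalArgs I ρ as)
    evalArg I ρ (aagg α Xs F) =
      aggFun α (λ rs → Σ (length rs ≡ length Xs) λ _ → sat I (updates ρ Xs rs) F)

    evalArgs : Interp → Env → List Arg → List (PTerm L)
    evalArgs I ρ [] = []
    evalArgs I ρ (a ∷ as) = evalArg I ρ a ∷ evalArgs I ρ as

    sat : Interp → Env → Formula → Set
    sat I ρ (fatom p as) = I (p , evalArgs I ρ as)
    sat I ρ (fcmp ≺ a b) = holds ≺ (evalArg I ρ a) (evalArg I ρ b)
    sat I ρ (fmem a t) = val (substT (λ x → just (ρ x)) t) (evalArg I ρ a)
    sat I ρ fbot = ⊥
    sat I ρ (F ⇒ G) = sat I ρ F → sat I ρ G
    sat I ρ (fall x F) = (r : PTerm L) → sat I (ρ [ x ↦ r ]) F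

  -- The translation φ^X (new variables are taken ≥ a counter k;
  -- the counter is threaded through)

  freshVars : ℕ → ℕ → List Var
  freshVars k 0 = []
  freshVars k (suc n) = k ∷ freshVars (suc k) n

  φLit : ℕ → Lit → Formula × ℕ
  φLit k (pos p ts) =
    let Xs = freshVars k (length ts) in
    fexs Xs (memAll Xs ts ∧ᶠ fatom p (map avar Xs)) , k + length ts
  φLit k (neg p ts) =
    let Xs = freshVars k (length ts) in
    fexs Xs (memAll Xs ts ∧ᶠ fneg (fatom p (map avar Xs))) , k + length ts

  φCmp : ℕ → Cmp → Term → Term → Formula × ℕ
  φCmp k ≺ t₁ t₂ =
    fexs (k ∷ suc k ∷ [])
      (conjᶠ (fmem (avar k) t₁ ∷ fmem (avar (suc k)) t₂ ∷ fcmp ≺ (avar k) (avar (suc k)) ∷ []))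
    , suc (suc k)

  φB : ℕ → BodyElem → Formula × ℕ
  φB k (lit l) = φLit k l
  φB k (cmp ≺ t₁ t₂) = φCmp k ≺ t₁ t₂

  φBs : ℕ → List BodyElem → List Formula × ℕ
  φBs k [] = [] , k
  φBs k (b ∷ bs) =
    let (F , k₁) = φB k b
        (Fs , k₂) = φBs k₁ bs
    in F ∷ Fs , k₂

  φBody : ℕ → List BodyElem → Formula × ℕ
  φBody k bs = conjᶠ (proj₁ (φBs k bs)) , proj₂ (φBs k bs)

  φE : List Var → ℕ → Elem → Formula × ℕ
  φE X k (lit l) = φLit k l
  φE X k (cmp ≺ t₁ t₂) = φCmp k ≺ t₁ t₂
  φE X k (agg α ts C' ≺ s) =
    let Zs = freshVars k (length ts)
        Y  = k + length ts
        (F , k') = φBody (suc Y) C'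
    in fex Y (fcmp ≺ (aagg α Zs (fexs X (memAll Zs ts ∧ᶠ F))) (avar Y) ∧ᶠ fmem (avar Y) s)
       , k'

  φEs : List Var → ℕ → List Elem → List Formula × ℕ
  φEs X k [] = [] , k
  φEs X k (e ∷ es) =
    let (F , k₁) = φE X k e
        (Fs , k₂) = φEs X k₁ es
    in F ∷ Fs , k₂

  φ : List Var → ℕ → List Elem → Formula
  φ X k C = conjᶠ (proj₁ (φEs X k C))

  data InfF : Set₂ where
    iatom : Atom → InfF
    ibot  : InfF
    ⋀ ⋁   : (H : Set₁) → (H → InfF) → InfF
    _⇛_   : InfF → InfF → InfF

  _⊨∞_ : Interp → InfF → Set₁
  I ⊨∞ iatom a = Lift (lsuc 0ℓ) (I a)
  I ⊨∞ ibot = Lift (lsuc 0ℓ) ⊥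
  I ⊨∞ ⋀ H F = (h : H) → I ⊨∞ F h
  I ⊨∞ ⋁ H F = Σ H λ h → I ⊨∞ F h
  I ⊨∞ (F ⇛ G) = I ⊨∞ F → I ⊨∞ G

  ineg : InfF → InfF
  ineg F = F ⇛ ibot

  itop : InfF
  itop = ineg ibot

  iconj : List InfF → InfF
  iconj Fs = ⋀ (Lift (lsuc 0ℓ) (Fin (length Fs))) (λ i → lookup Fs (lower i))

  -- The translation τ (an excluded-middle oracle is used to decide
  -- whether τ(t₁ ≺ t₂) is ⊤ or ⊥)

  module _ (lem : ExcludedMiddle (lsuc 0ℓ)) where

    τLit : Lit → InfF
    τLit (pos p ts) = ⋁ (Lift (lsuc 0ℓ) (Σ (List (PTerm L)) (valL ts)))
                        (λ h → iatom (p , proj₁ (lower h)))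
    τLit (neg p ts) = ⋁ (Lift (lsuc 0ℓ) (Σ (List (PTerm L)) (valL ts)))
                        (λ h → ineg (iatom (p , proj₁ (lower h))))

    decToInf : ∀ {P : Set₁} → Dec P → InfF
    decToInf (yes _) = itop
    decToInf (no _) = ibot

    τCmp : Cmp → Term → Term → InfF
    τCmp ≺ t₁ t₂ = decToInf (lem {Lift (lsuc 0ℓ)
                     (Σ (PTerm L) λ r₁ → Σ (PTerm L) λ r₂ → val t₁ r₁ × val t₂ r₂ × holds ≺ r₁ r₂)})

    τB : BodyElem → InfF
    τB (lit l) = τLit l
    τB (cmp ≺ t₁ t₂) = τCmp ≺ t₁ t₂

    τBody : List BodyElem → InfF
    τBody bs = iconj (map τB bs)

    τAgg : AggName → List Term → List BodyElem → Cmp → Term → InfF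
    τAgg α ts C' ≺ s =
      ⋀ (Σ (Pred A 0ℓ) λ Δ → ¬ Justifies Δ) λ h →
        ⋀ (Lift (lsuc 0ℓ) (Σ A (proj₁ h))) (λ i → τBody (map (substB (mkSub Y (proj₁ (lower i)))) C'))
        ⇛ ⋁ (Lift (lsuc 0ℓ) (Σ A (λ r → ¬ proj₁ h r))) (λ i → τBody (map (substB (mkSub Y (proj₁ (lower i)))) C'))
      where
      Y : List Var
      Y = deduplicate ℕ._≟_ (varsE (agg α ts C' ≺ s))
      A : Set
      A = Vec (PTerm L) (length Y)
      ⟦_⟧ : Pred A 0ℓ → Pred (List (PTerm L)) 0ℓ
      ⟦ Δ ⟧ z = Σ A λ r → Δ r × valL (substTs (mkSub Y r) ts) z
      -- Δ justifies the expression (s is precomputed, so [s] = {s})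
      Justifies : Pred A 0ℓ → Set
      Justifies Δ = Σ (PTerm L) λ r → val s r × holds ≺ (aggFun α ⟦ Δ ⟧) r

    τE : Elem → InfF
    τE (lit l) = τLit l
    τE (cmp ≺ t₁ t₂) = τCmp ≺ t₁ t₂
    τE (agg α ts C' ≺ s) = τAgg α ts C' ≺ s

    τ : List Elem → InfF
    τ C = iconj (map τE C)

module Submission where

-- The two translations are compared conjunct by conjunct, the free variables of φ being read
-- from an environment. For literals and comparisons, ∃X (X ∈ t ∧ …) over fresh X ranges
-- exactly over the values [t] that the disjunctions of τ enumerate. For an aggregate
-- expression E, let Δᴵ be the set of instances r of E whose body τ(C'ʳ) holds in I.
-- Classically τE holds iff Δᴵ justifies E, because among the non-justifying Δ only Δᴵ could
-- falsify its clause. On the φ side, assignments to X ⊇ vars(E) correspond to instances, so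
-- the set aggregated by α{Z | ∃X (Z ∈ t ∧ φC')} has the same elements as [Δᴵ]; since
-- aggregate functions are extensional, φE also says that Δᴵ justifies E.

open import Defs
open import Level using (0ℓ; Lift; lift; lower) renaming (suc to lsuc)
open import Data.Nat using (ℕ; suc; _+_; _<_; _≤_; _≟_; _≡ᵇ_)
open import Data.Nat.Properties
  using (≤-refl; ≤-trans; <-≤-trans; <-irrefl; m≤m+n; n≤1+n; suc-injective; ≡⇒≡ᵇ; ≡ᵇ⇒≡)
open import Data.Bool using (true; false; T; if_then_else_)
open import Data.List using (List; []; _∷_; _++_; map; length; deduplicate)
open import Data.List.Properties using (length-map)
import Data.List.Membership.Propositional as Mem
open import Data.List.Membership.Propositional.Properties using (∈-deduplicate⁺)
import Data.List.Relation.Unary.Any as Any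
open import Data.List.Relation.Unary.All using (All; []; _∷_)
open import Data.List.Relation.Unary.Unique.Propositional using (Unique)
open import Data.Vec using (Vec; []; _∷_)
import Data.Fin as Fin
open import Data.Maybe using (just; nothing; fromMaybe)
open import Data.Product using (Σ; ∃; _×_; _,_; proj₁; proj₂)
open import Data.Product.Function.NonDependent.Propositional using (_×-⇔_)
open import Data.Sum using (_⊎_; inj₁; inj₂; [_,_]; map₁)
open import Data.Empty using (⊥; ⊥-elim)
open import Data.Unit using (tt)
open import Function using (_∘_; id)
open import Function.Bundles using (_⇔_; mk⇔; Equivalence)
open import Function.Construct.Composition using (_⇔-∘_)
open import Function.Construct.Identity using (⇔-id)
open import Function.Construct.Symmetry using (⇔-sym)
open import Function.Related.TypeIsomorphisms using (¬-cong-⇔)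
open import Relation.Nullary using (¬_; Dec; yes; no; does)
open import Relation.Nullary.Decidable using (map′; dec-true; dec-false)
open import Relation.Unary using (Pred; _⊆_)
open import Relation.Binary.PropositionalEquality
  using (_≡_; _≢_; refl; trans; cong; cong₂; subst; subst₂) renaming (sym to ≡-sym)
open import Axiom.ExcludedMiddle using (ExcludedMiddle)
open import Axiom.DoubleNegationElimination using (DoubleNegationElimination; em⇒dne)

open Equivalence using (to; from)

module Correctness (L : Lang) (S : Sem L) where
  open Lang L
  open Sem S
  open Gringo L S

  Every : (Var → Set) → List Var → Set
  Every P xs = ∀ x → x ∈ₗ xs → P x

  AllBelow : ℕ → List Var → Set
  AllBelow k = Every (_< k)

  AgreeOn : List Var → Subst → Subst → Set
  AgreeOn xs σ σ' = Every (λ x → σ x ≡ σ' x) xs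

  ∈ₗ-++⁺ˡ : ∀ {A : Set} {x : A} {xs} ys → x ∈ₗ xs → x ∈ₗ (xs ++ ys)
  ∈ₗ-++⁺ˡ ys here = here
  ∈ₗ-++⁺ˡ ys (there p) = there (∈ₗ-++⁺ˡ ys p)

  ∈ₗ-++⁺ʳ : ∀ {A : Set} {x : A} xs {ys} → x ∈ₗ ys → x ∈ₗ (xs ++ ys)
  ∈ₗ-++⁺ʳ [] p = p
  ∈ₗ-++⁺ʳ (_ ∷ xs) p = there (∈ₗ-++⁺ʳ xs p)

  Every-++⁻ˡ : ∀ {P} xs {ys} → Every P (xs ++ ys) → Every P xs
  Every-++⁻ˡ xs h x p = h x (∈ₗ-++⁺ˡ _ p)

  Every-++⁻ʳ : ∀ {P} xs {ys} → Every P (xs ++ ys) → Every P ys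
  Every-++⁻ʳ xs h x p = h x (∈ₗ-++⁺ʳ xs p)

  ∈ₗ-++⁻ : ∀ {A : Set} {x : A} xs {ys} → x ∈ₗ (xs ++ ys) → x ∈ₗ xs ⊎ x ∈ₗ ys
  ∈ₗ-++⁻ [] p = inj₂ p
  ∈ₗ-++⁻ (_ ∷ xs) here = inj₁ here
  ∈ₗ-++⁻ (_ ∷ xs) (there p) = map₁ there (∈ₗ-++⁻ xs p)

  Every-++⁺ : ∀ {P} xs {ys} → Every P xs → Every P ys → Every P (xs ++ ys)
  Every-++⁺ xs hxs hys x p = [ hxs x , hys x ] (∈ₗ-++⁻ xs p)

  Every-[] : ∀ {P xs} → xs ≡ [] → Every P xs
  Every-[] refl x ()

  AllBelow-mono : ∀ {k k'} xs → k ≤ k' → AllBelow k xs → AllBelow k' xs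
  AllBelow-mono xs k≤k' h x p = <-≤-trans (h x p) k≤k'

  ∈ₗ⇒∈ : ∀ {A : Set} {x : A} {xs} → x ∈ₗ xs → x Mem.∈ xs
  ∈ₗ⇒∈ here = Any.here refl
  ∈ₗ⇒∈ (there p) = Any.there (∈ₗ⇒∈ p)

  ∈⇒∈ₗ : ∀ {A : Set} {x : A} {xs} → x Mem.∈ xs → x ∈ₗ xs
  ∈⇒∈ₗ (Any.here refl) = here
  ∈⇒∈ₗ (Any.there p) = there (∈⇒∈ₗ p)

  ∈ₗ-deduplicate⁺ : ∀ {x xs} → x ∈ₗ xs → x ∈ₗ deduplicate _≟_ xs
  ∈ₗ-deduplicate⁺ = ∈⇒∈ₗ ∘ ∈-deduplicate⁺ _≟_ ∘ ∈ₗ⇒∈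

  mutual
    substT-cong : ∀ {σ σ'} t → AgreeOn (varsT t) σ σ' → substT σ t ≡ substT σ' t
    substT-cong (tnum _) h = refl
    substT-cong (tsym _) h = refl
    substT-cong (tvar x) h rewrite h x here = refl
    substT-cong tinf h = refl
    substT-cong tsup h = refl
    substT-cong (tapp f ts) h = cong (tapp f) (substTs-cong ts h)
    substT-cong (top o ts) h = cong (top o) (substV-cong ts h)
    substT-cong (t₁ ‥ t₂) h =
      cong₂ _‥_ (substT-cong t₁ (Every-++⁻ˡ (varsT t₁) h)) (substT-cong t₂ (Every-++⁻ʳ (varsT t₁) h))

    substTs-cong : ∀ {σ σ'} ts → AgreeOn (varsTs ts) σ σ' → substTs σ ts ≡ substTs σ' ts
    substTs-cong [] h = refl
    substTs-cong (t ∷ ts) h =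
      cong₂ _∷_ (substT-cong t (Every-++⁻ˡ (varsT t) h)) (substTs-cong ts (Every-++⁻ʳ (varsT t) h))

    substV-cong : ∀ {n σ σ'} (ts : Vec Term n) → AgreeOn (varsV ts) σ σ' → substV σ ts ≡ substV σ' ts
    substV-cong [] h = refl
    substV-cong (t ∷ ts) h =
      cong₂ _∷_ (substT-cong t (Every-++⁻ˡ (varsT t) h)) (substV-cong ts (Every-++⁻ʳ (varsT t) h))

  substB-cong : ∀ {σ σ'} b → AgreeOn (varsB b) σ σ' → substB σ b ≡ substB σ' b
  substB-cong (lit (pos p ts)) h = cong (λ ts → BodyElem.lit (pos p ts)) (substTs-cong ts h)
  substB-cong (lit (neg p ts)) h = cong (λ ts → BodyElem.lit (neg p ts)) (substTs-cong ts h)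
  substB-cong (cmp ≺ t₁ t₂) h =
    cong₂ (cmp ≺) (substT-cong t₁ (Every-++⁻ˡ (varsT t₁) h)) (substT-cong t₂ (Every-++⁻ʳ (varsT t₁) h))

  substBs-cong : ∀ {σ σ'} bs → AgreeOn (varsBs bs) σ σ' → map (substB σ) bs ≡ map (substB σ') bs
  substBs-cong [] h = refl
  substBs-cong (b ∷ bs) h =
    cong₂ _∷_ (substB-cong b (Every-++⁻ˡ (varsB b) h)) (substBs-cong bs (Every-++⁻ʳ (varsB b) h))

  mutual
    substT-nothing : ∀ t → substT (λ _ → nothing) t ≡ t
    substT-nothing (tnum _) = refl
    substT-nothing (tsym _) = refl
    substT-nothing (tvar x) = refl
    substT-nothing tinf = refl
    substT-nothing tsup = refl
    substT-nothing (tapp f ts) = cong (tapp f) (substTs-nothing ts)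
    substT-nothing (top o ts) = cong (top o) (substV-nothing ts)
    substT-nothing (t₁ ‥ t₂) = cong₂ _‥_ (substT-nothing t₁) (substT-nothing t₂)

    substTs-nothing : ∀ ts → substTs (λ _ → nothing) ts ≡ ts
    substTs-nothing [] = refl
    substTs-nothing (t ∷ ts) = cong₂ _∷_ (substT-nothing t) (substTs-nothing ts)

    substV-nothing : ∀ {n} (ts : Vec Term n) → substV (λ _ → nothing) ts ≡ ts
    substV-nothing [] = refl
    substV-nothing (t ∷ ts) = cong₂ _∷_ (substT-nothing t) (substV-nothing ts)

  substT-ground : ∀ σ t → Ground t → substT σ t ≡ t
  substT-ground σ t g = trans (substT-cong t (Every-[] g)) (substT-nothing t)

  substLit-ground : ∀ σ l → varsLit l ≡ [] → substLit σ l ≡ l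
  substLit-ground σ (pos p ts) g = cong (pos p) (trans (substTs-cong ts (Every-[] g)) (substTs-nothing ts))
  substLit-ground σ (neg p ts) g = cong (neg p) (trans (substTs-cong ts (Every-[] g)) (substTs-nothing ts))

  mutual
    Precomputed⇒Ground : ∀ {t} → Precomputed t → Ground t
    Precomputed⇒Ground (num _) = refl
    Precomputed⇒Ground (sym _) = refl
    Precomputed⇒Ground inf = refl
    Precomputed⇒Ground sup = refl
    Precomputed⇒Ground (app f ts ps) = All-Precomputed⇒Ground ps

    All-Precomputed⇒Ground : ∀ {ts} → All Precomputed ts → varsTs ts ≡ []
    All-Precomputed⇒Ground [] = refl
    All-Precomputed⇒Ground (p ∷ ps) rewrite Precomputed⇒Ground p = All-Precomputed⇒Ground ps

  substTs-length : ∀ σ ts → length (substTs σ ts) ≡ length ts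
  substTs-length σ [] = refl
  substTs-length σ (t ∷ ts) = cong suc (substTs-length σ ts)

  valL-length : ∀ ts {rs} → valL ts rs → length rs ≡ length ts
  valL-length [] refl = refl
  valL-length (t ∷ ts) {_ ∷ rs} (_ , v) = cong suc (valL-length ts v)

  envSubst : Env → Subst
  envSubst ρ x = just (ρ x)

  update-≡ : ∀ (ρ : Env) x r → (ρ [ x ↦ r ]) x ≡ r
  update-≡ ρ x r = cong (if_then r else ρ x) (dec-true (x ≟ x) refl)

  update-≢ : ∀ (ρ : Env) {x y} r → y ≢ x → (ρ [ x ↦ r ]) y ≡ ρ y
  update-≢ ρ {x} {y} r y≢x = cong (if_then r else ρ y) (dec-false (y ≟ x) y≢x)

  updates-∉ : ∀ (ρ : Env) xs rs {y} → ¬ y ∈ₗ xs → updates ρ xs rs y ≡ ρ y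
  updates-∉ ρ [] rs y∉ = refl
  updates-∉ ρ (x ∷ xs) [] y∉ = refl
  updates-∉ ρ (x ∷ xs) (r ∷ rs) y∉ =
    trans (updates-∉ (ρ [ x ↦ r ]) xs rs (y∉ ∘ there)) (update-≢ ρ r λ { refl → y∉ here })

  updates-map : ∀ (ρ ρ' : Env) xs {y} → ρ y ≡ ρ' y ⊎ y ∈ₗ xs → updates ρ xs (map ρ' xs) y ≡ ρ' y
  updates-map ρ ρ' [] (inj₁ agree) = agree
  updates-map ρ ρ' (x ∷ xs) {y} h = updates-map (ρ [ x ↦ ρ' x ]) ρ' xs (step h)
    where
    step : ρ y ≡ ρ' y ⊎ y ∈ₗ (x ∷ xs) → (ρ [ x ↦ ρ' x ]) y ≡ ρ' y ⊎ y ∈ₗ xs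
    step (inj₂ here) = inj₁ (update-≡ ρ y (ρ' y))
    step (inj₂ (there p)) = inj₂ p
    step (inj₁ agree) with y ≟ x
    ... | yes refl = inj₁ (update-≡ ρ y (ρ' y))
    ... | no y≢x = inj₁ (trans (update-≢ ρ (ρ' x) y≢x) agree)

  freshVars-≥ : ∀ k n {y} → y ∈ₗ freshVars k n → k ≤ y
  freshVars-≥ k (suc n) here = ≤-refl
  freshVars-≥ k (suc n) (there p) = ≤-trans (n≤1+n k) (freshVars-≥ (suc k) n p)

  freshVars-length : ∀ k n → length (freshVars k n) ≡ n
  freshVars-length k 0 = refl
  freshVars-length k (suc n) = cong suc (freshVars-length (suc k) n)

  <⇒∉freshVars : ∀ k n {x} → x < k → ¬ x ∈ₗ freshVars k n
  <⇒∉freshVars k n x<k p = <-irrefl refl (<-≤-trans x<k (freshVars-≥ k n p))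

  map-updates-freshVars : ∀ (ρ : Env) k n zs → length zs ≡ n →
                          map (updates ρ (freshVars k n) zs) (freshVars k n) ≡ zs
  map-updates-freshVars ρ k 0 [] _ = refl
  map-updates-freshVars ρ k (suc n) (z ∷ zs) len =
    cong₂ _∷_ (trans (updates-∉ (ρ [ k ↦ z ]) (freshVars (suc k) n) zs (<⇒∉freshVars (suc k) n ≤-refl))
                     (update-≡ ρ k z))
              (map-updates-freshVars (ρ [ k ↦ z ]) (suc k) n zs (suc-injective len))

  updates-freshVars-agree : ∀ (ρ : Env) k n zs xs → AllBelow k xs →
                            AgreeOn xs (envSubst (updates ρ (freshVars k n) zs)) (envSubst ρ)
  updates-freshVars-agree ρ k n zs xs xs<k x p =
    cong just (updates-∉ ρ (freshVars k n) zs (<⇒∉freshVars k n (xs<k x p)))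

  valuesAt : (Y : List Var) → Env → Vec (PTerm L) (length Y)
  valuesAt [] ρ = []
  valuesAt (y ∷ Y) ρ = ρ y ∷ valuesAt Y ρ

  override : Env → (Y : List Var) → Vec (PTerm L) (length Y) → Env
  override ρ Y r y = fromMaybe (ρ y) (mkSub Y r y)

  ≡ᵇ-refl≢false : ∀ y → (y ≡ᵇ y) ≢ false
  ≡ᵇ-refl≢false y b = subst T b (≡⇒≡ᵇ y y refl)

  mkSub-valuesAt : ∀ Y (ρ : Env) {y} → y ∈ₗ Y → mkSub Y (valuesAt Y ρ) y ≡ just (ρ y)
  mkSub-valuesAt (y ∷ Y) ρ here with y ≡ᵇ y in b
  ... | true = refl
  ... | false = ⊥-elim (≡ᵇ-refl≢false y b)
  mkSub-valuesAt (y' ∷ Y) ρ {y} (there p) with y ≡ᵇ y' in b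
  ... | true = cong (just ∘ ρ) (≡-sym (≡ᵇ⇒≡ y y' (subst T (≡-sym b) tt)))
  ... | false = mkSub-valuesAt Y ρ p

  mkSub-override : ∀ (ρ : Env) Y r {y} → y ∈ₗ Y → mkSub Y r y ≡ just (override ρ Y r y)
  mkSub-override ρ (y ∷ Y) (r ∷ rs) here with y ≡ᵇ y in b
  ... | true = refl
  ... | false = ⊥-elim (≡ᵇ-refl≢false y b)
  mkSub-override ρ (y' ∷ Y) (r ∷ rs) {y} (there p) with y ≡ᵇ y'
  ... | true = refl
  ... | false = mkSub-override ρ Y rs p

  φLit-increasing : ∀ k l → k ≤ proj₂ (φLit k l)
  φLit-increasing k (pos p ts) = m≤m+n k (length ts)
  φLit-increasing k (neg p ts) = m≤m+n k (length ts)

  φCmp-increasing : ∀ k ≺ t₁ t₂ → k ≤ proj₂ (φCmp k ≺ t₁ t₂)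
  φCmp-increasing k ≺ t₁ t₂ = ≤-trans (n≤1+n k) (n≤1+n (suc k))

  φB-increasing : ∀ k b → k ≤ proj₂ (φB k b)
  φB-increasing k (lit l) = φLit-increasing k l
  φB-increasing k (cmp ≺ t₁ t₂) = φCmp-increasing k ≺ t₁ t₂

  φBs-increasing : ∀ k bs → k ≤ proj₂ (φBs k bs)
  φBs-increasing k [] = ≤-refl
  φBs-increasing k (b ∷ bs) = ≤-trans (φB-increasing k b) (φBs-increasing (proj₂ (φB k b)) bs)

  φE-increasing : ∀ X k e → k ≤ proj₂ (φE X k e)
  φE-increasing X k (lit l) = φLit-increasing k l
  φE-increasing X k (cmp ≺ t₁ t₂) = φCmp-increasing k ≺ t₁ t₂
  φE-increasing X k (agg α ts C' ≺ s) =
    ≤-trans (m≤m+n k (length ts)) (≤-trans (n≤1+n (k + length ts)) (φBs-increasing (suc (k + length ts)) C'))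

  holds₂ : Cmp → Pred (List (PTerm L)) 0ℓ
  holds₂ ≺ (r₁ ∷ r₂ ∷ []) = holds ≺ r₁ r₂
  holds₂ ≺ _ = ⊥

  -- τ of an aggregate expression, over instances A, with the justification predicate and the
  -- instantiated bodies abstracted
  unjustifiedClauses : {A : Set} → Pred (Pred A 0ℓ) 0ℓ → (A → InfF) → InfF
  unjustifiedClauses {A} Justifies B =
    ⋀ (Σ (Pred A 0ℓ) λ Δ → ¬ Justifies Δ) λ h →
      ⋀ (Lift (lsuc 0ℓ) (Σ A (proj₁ h))) (λ i → B (proj₁ (lower i)))
      ⇛ ⋁ (Lift (lsuc 0ℓ) (Σ A (λ r → ¬ proj₁ h r))) (λ i → B (proj₁ (lower i)))

  module Classical (lem : ExcludedMiddle (lsuc 0ℓ)) (I : Interp) where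

    dne₁ : DoubleNegationElimination (lsuc 0ℓ)
    dne₁ = em⇒dne lem

    dne : DoubleNegationElimination 0ℓ
    dne = em⇒dne (map′ lower lift lem)

    sat-∧ : ∀ ρ F G → sat I ρ (F ∧ᶠ G) ⇔ (sat I ρ F × sat I ρ G)
    sat-∧ ρ F G = mk⇔ (λ h → dne (λ ¬f → h (λ f _ → ¬f f)) , dne (λ ¬g → h (λ _ g → ¬g g)))
                      (λ (f , g) h → h f g)

    sat-conjᶠ-∷ : ∀ ρ F Fs → sat I ρ (conjᶠ (F ∷ Fs)) ⇔ (sat I ρ F × sat I ρ (conjᶠ Fs))
    sat-conjᶠ-∷ ρ F [] = mk⇔ (_, λ ()) proj₁
    sat-conjᶠ-∷ ρ F (G ∷ Gs) = sat-∧ ρ F (conjᶠ (G ∷ Gs))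

    sat-fex : ∀ ρ x F → sat I ρ (fex x F) ⇔ (∃ λ r → sat I (ρ [ x ↦ r ]) F)
    sat-fex ρ x F = mk⇔ (λ h → dne (λ ¬∃ → h (λ r f → ¬∃ (r , f)))) (λ (r , f) h → h r f)

    sat-fexs : ∀ ρ xs F → sat I ρ (fexs xs F) ⇔ (∃ λ z → length z ≡ length xs × sat I (updates ρ xs z) F)
    sat-fexs ρ [] F = mk⇔ (λ f → [] , refl , f) λ { ([] , _ , f) → f }
    sat-fexs ρ (x ∷ xs) F = mk⇔
      (λ h → let r , h' = to (sat-fex ρ x (fexs xs F)) h
                 z , len , f = to (sat-fexs (ρ [ x ↦ r ]) xs F) h'
             in r ∷ z , cong suc len , f)
      (λ { (r ∷ z , len , f) →
             from (sat-fex ρ x (fexs xs F)) (r , from (sat-fexs (ρ [ x ↦ r ]) xs F) (z , suc-injective len , f)) })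

    sat-memAll : ∀ ρ xs ts → length xs ≡ length ts →
                 sat I ρ (memAll xs ts) ⇔ valL (substTs (envSubst ρ) ts) (map ρ xs)
    sat-memAll ρ [] [] _ = mk⇔ (λ _ → refl) (λ _ ())
    sat-memAll ρ (x ∷ []) (t ∷ []) _ = mk⇔ (_, refl) proj₁
    sat-memAll ρ (x ∷ x' ∷ xs) (t ∷ t' ∷ ts) len =
      (⇔-id _ ×-⇔ sat-memAll ρ (x' ∷ xs) (t' ∷ ts) (suc-injective len))
      ⇔-∘ sat-∧ ρ (fmem (avar x) t) (memAll (x' ∷ xs) (t' ∷ ts))
    sat-memAll ρ (x ∷ []) (t ∷ _ ∷ _) ()
    sat-memAll ρ (x ∷ _ ∷ _) (t ∷ []) ()

    sat-fatom-avar : ∀ ρ p xs → sat I ρ (fatom p (map avar xs)) ⇔ I (p , map ρ xs)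
    sat-fatom-avar ρ p xs = mk⇔ (subst (λ rs → I (p , rs)) (evalArgs-avar xs))
                                (subst (λ rs → I (p , rs)) (≡-sym (evalArgs-avar xs)))
      where
      evalArgs-avar : ∀ xs → evalArgs I ρ (map avar xs) ≡ map ρ xs
      evalArgs-avar [] = refl
      evalArgs-avar (x ∷ xs) = cong (ρ x ∷_) (evalArgs-avar xs)

    ⊨-iconj-[] : I ⊨∞ iconj []
    ⊨-iconj-[] (lift ())

    ⊨-iconj-∷ : ∀ F Fs → (I ⊨∞ iconj (F ∷ Fs)) ⇔ ((I ⊨∞ F) × (I ⊨∞ iconj Fs))
    ⊨-iconj-∷ F Fs = mk⇔ (λ h → h (lift Fin.zero) , h ∘ lift ∘ Fin.suc ∘ lower)
                         (λ { (f , fs) (lift Fin.zero) → f ; (f , fs) (lift (Fin.suc i)) → fs (lift i) })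

    conj-∷-⇔ : ∀ ρ F Fs G Gs → sat I ρ F ⇔ (I ⊨∞ G) → sat I ρ (conjᶠ Fs) ⇔ (I ⊨∞ iconj Gs) →
               sat I ρ (conjᶠ (F ∷ Fs)) ⇔ (I ⊨∞ iconj (G ∷ Gs))
    conj-∷-⇔ ρ F Fs G Gs F⇔G Fs⇔Gs = ⇔-sym (⊨-iconj-∷ G Gs) ⇔-∘ ((F⇔G ×-⇔ Fs⇔Gs) ⇔-∘ sat-conjᶠ-∷ ρ F Fs)

    ⊨-decToInf : ∀ {P : Set₁} (d : Dec P) → (I ⊨∞ decToInf lem d) ⇔ P
    ⊨-decToInf (yes p) = mk⇔ (λ _ → p) (λ _ → id)
    ⊨-decToInf (no ¬p) = mk⇔ (⊥-elim ∘ lower) (⊥-elim ∘ ¬p)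

    sat-∃fresh : ∀ ρ k ts B (Q : Pred (List (PTerm L)) 0ℓ) → AllBelow k (varsTs ts) →
                 let Zs = freshVars k (length ts) in
                 (∀ ρ' → sat I ρ' B ⇔ (valL (substTs (envSubst ρ') ts) (map ρ' Zs) × Q (map ρ' Zs))) →
                 sat I ρ (fexs Zs B) ⇔ (∃ λ z → valL (substTs (envSubst ρ) ts) z × Q z)
    sat-∃fresh ρ k ts B Q ts<k B⇔ = mk⇔ to′ from′ ⇔-∘ sat-fexs ρ Zs B
      where
      n : ℕ
      n = length ts
      Zs : List Var
      Zs = freshVars k n

      map≡ : ∀ z → length z ≡ n → map (updates ρ Zs z) Zs ≡ z
      map≡ = map-updates-freshVars ρ k n

      ts≡ : ∀ z → substTs (envSubst (updates ρ Zs z)) ts ≡ substTs (envSubst ρ) ts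
      ts≡ z = substTs-cong ts (updates-freshVars-agree ρ k n z (varsTs ts) ts<k)

      to′ : (∃ λ z → length z ≡ length Zs × sat I (updates ρ Zs z) B) →
            ∃ λ z → valL (substTs (envSubst ρ) ts) z × Q z
      to′ (z , len , b) =
        let len′ = trans len (freshVars-length k n)
            v , q = to (B⇔ (updates ρ Zs z)) b
        in z , subst₂ valL (ts≡ z) (map≡ z len′) v , subst Q (map≡ z len′) q

      from′ : (∃ λ z → valL (substTs (envSubst ρ) ts) z × Q z) →
              ∃ λ z → length z ≡ length Zs × sat I (updates ρ Zs z) B
      from′ (z , v , q) =
        let len = trans (valL-length _ v) (substTs-length _ ts)
        in z , trans len (≡-sym (freshVars-length k n))
             , from (B⇔ (updates ρ Zs z))
                    (subst₂ valL (≡-sym (ts≡ z)) (≡-sym (map≡ z len)) v , subst Q (≡-sym (map≡ z len)) q)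

    φLit-correct : ∀ ρ k l → AllBelow k (varsLit l) →
                   sat I ρ (proj₁ (φLit k l)) ⇔ (I ⊨∞ τLit lem (substLit (envSubst ρ) l))
    φLit-correct ρ k (pos p ts) ts<k =
      mk⇔ (λ (z , v , a) → lift (z , v) , lift a) (λ (lift (z , v) , lift a) → z , v , a)
      ⇔-∘ sat-∃fresh ρ k ts (memAll Zs ts ∧ᶠ fatom p (map avar Zs)) (λ z → I (p , z)) ts<k λ ρ' →
            (sat-memAll ρ' Zs ts (freshVars-length k _) ×-⇔ sat-fatom-avar ρ' p Zs)
            ⇔-∘ sat-∧ ρ' (memAll Zs ts) (fatom p (map avar Zs))
      where
      Zs : List Var
      Zs = freshVars k (length ts)
    φLit-correct ρ k (neg p ts) ts<k =
      mk⇔ (λ (z , v , ¬a) → lift (z , v) , lift ∘ ¬a ∘ lower)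
          (λ (lift (z , v) , ¬a) → z , v , lower ∘ ¬a ∘ lift)
      ⇔-∘ sat-∃fresh ρ k ts (memAll Zs ts ∧ᶠ fneg (fatom p (map avar Zs))) (λ z → ¬ I (p , z)) ts<k λ ρ' →
            (sat-memAll ρ' Zs ts (freshVars-length k _) ×-⇔ ¬-cong-⇔ (sat-fatom-avar ρ' p Zs))
            ⇔-∘ sat-∧ ρ' (memAll Zs ts) (fneg (fatom p (map avar Zs)))
      where
      Zs : List Var
      Zs = freshVars k (length ts)

    φCmp-correct : ∀ ρ k ≺ t₁ t₂ → AllBelow k (varsT t₁ ++ varsT t₂) →
                   sat I ρ (proj₁ (φCmp k ≺ t₁ t₂))
                   ⇔ (I ⊨∞ τCmp lem ≺ (substT (envSubst ρ) t₁) (substT (envSubst ρ) t₂))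
    φCmp-correct ρ k ≺ t₁ t₂ t<k =
      ⇔-sym (⊨-decToInf _)
      ⇔-∘ (mk⇔ (λ { (r₁ ∷ r₂ ∷ [] , (v₁ , v₂ , _) , h) → lift (r₁ , r₂ , v₁ , v₂ , h) })
               (λ (lift (r₁ , r₂ , v₁ , v₂ , h)) → r₁ ∷ r₂ ∷ [] , (v₁ , v₂ , refl) , h)
      ⇔-∘ sat-∃fresh ρ k (t₁ ∷ t₂ ∷ []) (X₁∈t₁ ∧ᶠ (X₂∈t₂ ∧ᶠ X₁≺X₂)) (holds₂ ≺) ts<k λ ρ' →
            mk⇔ (λ (v₁ , v₂ , h) → (v₁ , v₂ , refl) , h) (λ ((v₁ , v₂ , _) , h) → v₁ , v₂ , h)
            ⇔-∘ ((⇔-id _ ×-⇔ sat-∧ ρ' X₂∈t₂ X₁≺X₂) ⇔-∘ sat-∧ ρ' X₁∈t₁ (X₂∈t₂ ∧ᶠ X₁≺X₂)))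
      where
      X₁∈t₁ X₂∈t₂ X₁≺X₂ : Formula
      X₁∈t₁ = fmem (avar k) t₁
      X₂∈t₂ = fmem (avar (suc k)) t₂
      X₁≺X₂ = fcmp ≺ (avar k) (avar (suc k))
      ts<k : AllBelow k (varsTs (t₁ ∷ t₂ ∷ []))
      ts<k = Every-++⁺ (varsT t₁) (Every-++⁻ˡ (varsT t₁) t<k)
                       (Every-++⁺ (varsT t₂) (Every-++⁻ʳ (varsT t₁) t<k) λ _ ())

    φB-correct : ∀ ρ k b → AllBelow k (varsB b) →
                 sat I ρ (proj₁ (φB k b)) ⇔ (I ⊨∞ τB lem (substB (envSubst ρ) b))
    φB-correct ρ k (lit l) = φLit-correct ρ k l
    φB-correct ρ k (cmp ≺ t₁ t₂) = φCmp-correct ρ k ≺ t₁ t₂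

    φBody-correct : ∀ ρ k bs → AllBelow k (varsBs bs) →
                    sat I ρ (proj₁ (φBody k bs)) ⇔ (I ⊨∞ τBody lem (map (substB (envSubst ρ)) bs))
    φBody-correct ρ k [] _ = mk⇔ (λ _ → ⊨-iconj-[]) (λ _ ())
    φBody-correct ρ k (b ∷ bs) b∷bs<k =
      conj-∷-⇔ ρ (proj₁ (φB k b)) (proj₁ (φBs k′ bs))
                 (τB lem (substB (envSubst ρ) b)) (map (τB lem) (map (substB (envSubst ρ)) bs))
        (φB-correct ρ k b (Every-++⁻ˡ (varsB b) b∷bs<k))
        (φBody-correct ρ k′ bs (AllBelow-mono (varsBs bs) (φB-increasing k b) (Every-++⁻ʳ (varsB b) b∷bs<k)))
      where
      k′ : ℕ
      k′ = proj₂ (φB k b)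

    -- decided by lem, since I ⊨∞ B r lives in Set₁ while subsets of A are Set-valued
    satisfiedBy : {A : Set} → (A → InfF) → Pred A 0ℓ
    satisfiedBy B r = T (does (lem {I ⊨∞ B r}))

    satisfiedBy-⇔ : ∀ {A : Set} (B : A → InfF) r → satisfiedBy B r ⇔ (I ⊨∞ B r)
    satisfiedBy-⇔ B r with lem {I ⊨∞ B r}
    ... | yes b = mk⇔ (λ _ → b) (λ _ → tt)
    ... | no ¬b = mk⇔ (λ ()) ¬b

    ⊨-unjustifiedClauses : ∀ {A : Set} (Justifies : Pred (Pred A 0ℓ) 0ℓ) (B : A → InfF) →
                           (∀ {Δ Δ′} → Δ ⊆ Δ′ → Δ′ ⊆ Δ → Justifies Δ → Justifies Δ′) →
                           (I ⊨∞ unjustifiedClauses Justifies B) ⇔ Justifies (satisfiedBy B)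
    ⊨-unjustifiedClauses Justifies B resp = mk⇔ to′ from′
      where
      to′ : I ⊨∞ unjustifiedClauses Justifies B → Justifies (satisfiedBy B)
      to′ h = dne λ ¬J →
        let lift (r , r∉) , b = h (satisfiedBy B , ¬J) (λ (lift (r , r∈)) → to (satisfiedBy-⇔ B r) r∈)
        in r∉ (from (satisfiedBy-⇔ B r) b)

      from′ : Justifies (satisfiedBy B) → I ⊨∞ unjustifiedClauses Justifies B
      from′ J (Δ , ¬JΔ) ant = dne₁ λ ¬b → ¬JΔ (resp (satisfied⊆Δ ¬b) Δ⊆satisfied J)
        where
        Δ⊆satisfied : Δ ⊆ satisfiedBy B
        Δ⊆satisfied {r} r∈ = from (satisfiedBy-⇔ B r) (ant (lift (r , r∈)))
        satisfied⊆Δ : ¬ (I ⊨∞ ⋁ (Lift (lsuc 0ℓ) (Σ _ (λ r → ¬ Δ r))) (λ i → B (proj₁ (lower i)))) →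
                      satisfiedBy B ⊆ Δ
        satisfied⊆Δ ¬b {r} r∈ = dne λ r∉ → ¬b (lift (r , r∉) , to (satisfiedBy-⇔ B r) r∈)

    -- Y, A, ⟦_⟧ and Justifies are the local definitions of τAgg.
    module Aggregate (α : AggName) (ts : List Term) (C' : List BodyElem) (≺ : Cmp) (s : Term) where
      e : Elem
      e = agg α ts C' ≺ s

      Y : List Var
      Y = deduplicate _≟_ (varsE e)

      A : Set
      A = Vec (PTerm L) (length Y)

      ⟦_⟧ : Pred A 0ℓ → Pred (List (PTerm L)) 0ℓ
      ⟦ Δ ⟧ z = ∃ λ r → Δ r × valL (substTs (mkSub Y r) ts) z

      Justifies : Pred (Pred A 0ℓ) 0ℓ
      Justifies Δ = ∃ λ r → val s r × holds ≺ (aggFun α ⟦ Δ ⟧) r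

      bodyAt : A → InfF
      bodyAt r = τBody lem (map (substB (mkSub Y r)) C')

      Δᴵ : Pred A 0ℓ
      Δᴵ = satisfiedBy bodyAt

      τAgg-correct : (I ⊨∞ τAgg lem α ts C' ≺ s) ⇔ Justifies Δᴵ
      τAgg-correct = ⊨-unjustifiedClauses Justifies bodyAt λ Δ⊆Δ′ Δ′⊆Δ (r , v , h) →
        r , v , subst (λ a → holds ≺ a r) (aggFun-ext α _ _ (⟦⟧-mono Δ⊆Δ′) (⟦⟧-mono Δ′⊆Δ)) h
        where
        ⟦⟧-mono : ∀ {Δ Δ′} → Δ ⊆ Δ′ → ∀ z → ⟦ Δ ⟧ z → ⟦ Δ′ ⟧ z
        ⟦⟧-mono Δ⊆Δ′ z (r , r∈ , v) = r , Δ⊆Δ′ r∈ , v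

      module _ (X : List Var) (k : ℕ) (e⊆X : Every (_∈ₗ X) (varsE e)) (e<k : AllBelow k (varsE e))
               (X<k : AllBelow k X) where
        n : ℕ
        n = length ts

        Zs : List Var
        Zs = freshVars k n

        -- the variable Y of φ^X, which ranges over [s]
        resVar : Var
        resVar = k + n

        F : Formula
        F = proj₁ (φBody (suc resVar) C')

        G : Formula
        G = fexs X (memAll Zs ts ∧ᶠ F)

        Matches : Env → List (PTerm L) → Set₁
        Matches ρ z = valL (substTs (envSubst ρ) ts) z × (I ⊨∞ τBody lem (map (substB (envSubst ρ)) C'))

        sat-memAll∧F : ∀ ρ z → map ρ Zs ≡ z → sat I ρ (memAll Zs ts ∧ᶠ F) ⇔ Matches ρ z
        sat-memAll∧F ρ z Zs↦z =
          (mk⇔ (subst (valL _) Zs↦z) (subst (valL _) (≡-sym Zs↦z))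
           ×-⇔ φBody-correct ρ (suc resVar) C' C'<k)
          ⇔-∘ ((sat-memAll ρ Zs ts (freshVars-length k n) ×-⇔ ⇔-id _) ⇔-∘ sat-∧ ρ (memAll Zs ts) F)
          where
          C'<k : AllBelow (suc resVar) (varsBs C')
          C'<k x p = ≤-trans (e<k x (∈ₗ-++⁺ʳ (varsTs ts) (∈ₗ-++⁺ˡ (varsT s) p)))
                             (≤-trans (m≤m+n k n) (n≤1+n resVar))

        Matches-agree : ∀ ρ r z → AgreeOn (varsE e) (mkSub Y r) (envSubst ρ) →
                        (Δᴵ r × valL (substTs (mkSub Y r) ts) z) ⇔ Matches ρ z
        Matches-agree ρ r z agree = mk⇔
          (λ (r∈ , v) → subst (λ ts′ → valL ts′ z) ts≡ v
                      , subst (λ C″ → I ⊨∞ τBody lem C″) C'≡ (to (satisfiedBy-⇔ bodyAt r) r∈))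
          (λ (v , b) → from (satisfiedBy-⇔ bodyAt r) (subst (λ C″ → I ⊨∞ τBody lem C″) (≡-sym C'≡) b)
                     , subst (λ ts′ → valL ts′ z) (≡-sym ts≡) v)
          where
          ts≡ : substTs (mkSub Y r) ts ≡ substTs (envSubst ρ) ts
          ts≡ = substTs-cong ts (Every-++⁻ˡ (varsTs ts) agree)
          C'≡ : map (substB (mkSub Y r)) C' ≡ map (substB (envSubst ρ)) C'
          C'≡ = substBs-cong C' (Every-++⁻ˡ (varsBs C') (Every-++⁻ʳ (varsTs ts) agree))

        map-Zs : ∀ ρ z xs → length z ≡ n → map (updates (updates ρ Zs z) X xs) Zs ≡ z
        map-Zs ρ z xs len =
          trans (map-cong-∈ Zs λ y y∈Zs → updates-∉ _ X xs λ y∈X → <⇒∉freshVars k n (X<k y y∈X) y∈Zs)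
                (map-updates-freshVars ρ k n z len)
          where
          map-cong-∈ : ∀ {f g : Env} ys → Every (λ y → f y ≡ g y) ys → map f ys ≡ map g ys
          map-cong-∈ [] _ = refl
          map-cong-∈ (y ∷ ys) fy≡gy = cong₂ _∷_ (fy≡gy y here) (map-cong-∈ ys (λ w p → fy≡gy w (there p)))

        ∈⟦Δᴵ⟧ : ∀ ρ z → (Σ (length z ≡ length Zs) λ _ → sat I (updates ρ Zs z) G) ⇔ ⟦ Δᴵ ⟧ z
        ∈⟦Δᴵ⟧ ρ z = mk⇔ to′ from′
          where
          ρz : Env
          ρz = updates ρ Zs z

          to′ : (Σ (length z ≡ length Zs) λ _ → sat I ρz G) → ⟦ Δᴵ ⟧ z
          to′ (len , g) =
            let xs , _ , b = to (sat-fexs ρz X _) g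
                ρ″ = updates ρz X xs
                agree : AgreeOn (varsE e) (mkSub Y (valuesAt Y ρ″)) (envSubst ρ″)
                agree y p = mkSub-valuesAt Y ρ″ (∈ₗ-deduplicate⁺ p)
                m = to (sat-memAll∧F ρ″ z (map-Zs ρ z xs (trans len (freshVars-length k n)))) b
                r∈ , v = from (Matches-agree ρ″ (valuesAt Y ρ″) z agree) m
            in valuesAt Y ρ″ , r∈ , v

          from′ : ⟦ Δᴵ ⟧ z → Σ (length z ≡ length Zs) λ _ → sat I ρz G
          from′ (r , r∈ , v) =
            let ρr = override ρ Y r
                ρ″ = updates ρz X (map ρr X)
                agree : AgreeOn (varsE e) (mkSub Y r) (envSubst ρ″)
                agree y p = trans (mkSub-override ρ Y r (∈ₗ-deduplicate⁺ p))
                                  (cong just (≡-sym (updates-map ρz ρr X (inj₂ (e⊆X y p)))))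
                len = trans (valL-length _ v) (substTs-length _ ts)
                m = to (Matches-agree ρ″ r z agree) (r∈ , v)
                b = from (sat-memAll∧F ρ″ z (map-Zs ρ z (map ρr X) len)) m
            in trans len (≡-sym (freshVars-length k n)) , from (sat-fexs ρz X _) (map ρr X , length-map ρr X , b)

        φAgg-correct : ∀ ρ → Precomputed s → sat I ρ (proj₁ (φE X k e)) ⇔ Justifies Δᴵ
        φAgg-correct ρ s-pre = mk⇔ to′ from′ ⇔-∘ sat-fex ρ resVar (Agg≺res ∧ᶠ res∈s)
          where
          Agg≺res res∈s : Formula
          Agg≺res = fcmp ≺ (aagg α Zs G) (avar resVar)
          res∈s = fmem (avar resVar) s

          aggregate≡ : ∀ ρ′ → evalArg I ρ′ (aagg α Zs G) ≡ aggFun α ⟦ Δᴵ ⟧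
          aggregate≡ ρ′ = aggFun-ext α _ _ (λ z → to (∈⟦Δᴵ⟧ ρ′ z)) (λ z → from (∈⟦Δᴵ⟧ ρ′ z))

          s≡ : ∀ σ → substT σ s ≡ s
          s≡ σ = substT-ground σ s (Precomputed⇒Ground s-pre)

          to′ : (∃ λ v → sat I (ρ [ resVar ↦ v ]) (Agg≺res ∧ᶠ res∈s)) → Justifies Δᴵ
          to′ (v , b) =
            let ρv = ρ [ resVar ↦ v ]
                h , m = to (sat-∧ ρv Agg≺res res∈s) b
            in v , subst₂ val (s≡ _) (update-≡ ρ resVar v) m
                 , subst₂ (holds ≺) (aggregate≡ ρv) (update-≡ ρ resVar v) h

          from′ : Justifies Δᴵ → ∃ λ v → sat I (ρ [ resVar ↦ v ]) (Agg≺res ∧ᶠ res∈s)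
          from′ (v , m , h) =
            let ρv = ρ [ resVar ↦ v ]
            in v , from (sat-∧ ρv Agg≺res res∈s)
                        ( subst₂ (holds ≺) (≡-sym (aggregate≡ ρv)) (≡-sym (update-≡ ρ resVar v)) h
                        , subst₂ val (≡-sym (s≡ _)) (≡-sym (update-≡ ρ resVar v)) m)

    φE-correct : ∀ ρ X k e → GroundOrClosed e → Every (_∈ₗ X) (varsE e) → AllBelow k (varsE e) → AllBelow k X →
                 sat I ρ (proj₁ (φE X k e)) ⇔ (I ⊨∞ τE lem e)
    φE-correct ρ X k (lit l) (lit _ ground) _ l<k _ =
      subst (λ l′ → sat I ρ (proj₁ (φLit k l)) ⇔ (I ⊨∞ τLit lem l′))
            (substLit-ground _ l ground) (φLit-correct ρ k l l<k)
    φE-correct ρ X k (cmp ≺ t₁ t₂) (cmp _ _ _ ground₁ ground₂) _ t<k _ =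
      subst₂ (λ t₁′ t₂′ → sat I ρ (proj₁ (φCmp k ≺ t₁ t₂)) ⇔ (I ⊨∞ τCmp lem ≺ t₁′ t₂′))
             (substT-ground _ t₁ ground₁) (substT-ground _ t₂ ground₂) (φCmp-correct ρ k ≺ t₁ t₂ t<k)
    φE-correct ρ X k (agg α ts C' ≺ s) (agg _ _ _ _ _ _ s-pre) e⊆X e<k X<k =
      ⇔-sym τAgg-correct ⇔-∘ φAgg-correct X k e⊆X e<k X<k ρ s-pre
      where open Aggregate α ts C' ≺ s

    φ-correct : ∀ ρ X k C → All GroundOrClosed C → Every (_∈ₗ X) (varsC C) → AllBelow k (varsC C) → AllBelow k X →
                sat I ρ (φ X k C) ⇔ (I ⊨∞ τ lem C)
    φ-correct ρ X k [] [] _ _ _ = mk⇔ (λ _ → ⊨-iconj-[]) (λ _ ())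
    φ-correct ρ X k (e ∷ es) (g ∷ gs) C⊆X C<k X<k =
      conj-∷-⇔ ρ (proj₁ (φE X k e)) (proj₁ (φEs X k′ es)) (τE lem e) (map (τE lem) es)
        (φE-correct ρ X k e g (Every-++⁻ˡ (varsE e) C⊆X) (Every-++⁻ˡ (varsE e) C<k) X<k)
        (φ-correct ρ X k′ es gs (Every-++⁻ʳ (varsE e) C⊆X)
          (AllBelow-mono (varsC es) k≤k′ (Every-++⁻ʳ (varsE e) C<k)) (AllBelow-mono X k≤k′ X<k))
      where
      k′ : ℕ
      k′ = proj₂ (φE X k e)
      k≤k′ : k ≤ k′
      k≤k′ = φE-increasing X k e

lemma3 : (L : Lang) (S : Sem L) → let open Gringo L S in
    (lem : ExcludedMiddle (lsuc 0ℓ))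
    (C : List Elem) → All GroundOrClosed C →
    (X : List Var) → Unique X → (∀ x → x ∈ₗ varsC C → x ∈ₗ X) →
    (k : ℕ) → (∀ x → x ∈ₗ varsC C → x < k) → (∀ x → x ∈ₗ X → x < k) →
    (I : Interp) → (∀ a → I a → Voc C a) → (ρ : Env) →
    (I ⊨∞ τ lem C → sat I ρ (φ X k C)) × (sat I ρ (φ X k C) → I ⊨∞ τ lem C)
lemma3 L S lem C C-closed X _ C⊆X k C<k X<k I _ ρ = from φ⇔τ , to φ⇔τ
  where
  open Gringo L S
  open Correctness.Classical L S lem I
  φ⇔τ : sat I ρ (φ X k C) ⇔ (I ⊨∞ τ lem C)
  φ⇔τ = φ-correct ρ X k C C-closed C⊆X C<k X<k
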